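{- Let $r$, $s$, $c$, $d$ and $a_n$ be any integers with $r\neq0$, $r+d\neq0$, and suppose $U_r$, $U_d$, $U_{r+d}$ are nonzero. Let $n$ be a positive integer. Then \[ \begin{split} &\sum_{a_{n-1}=c}^{a_n}\sum_{a_{n-2}=c}^{a_{n-1}}\cdots\sum_{a_0=c}^{a_1}\left(\frac{U_d}{U_{r+d}}\right)^{a_0}W_{ra_0+s} =\frac{(-1)^nU_d^{n+a_n}}{q^{dn}U_r^nU_{r+d}^{a_n}}W_{(r+d)n+ra_n+s}\\ &\qquad-\left(\frac{U_d}{U_{r+d}}\right)^{c-1}\sum_{j=0}^{n-1}\frac{(-1)^{n-j}}{q^{d(n-j)}}\left(\frac{U_d}{U_r}\right)^{n-j}W_{r(n-j+c-1)+d(n-j)+s}\binom{a_n+j-c}{j}. \end{split} \]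
   Context: Let $a,b,p,q$ be complex numbers with $p\neq0$, $q\neq0$. The Horadam sequence $W_j=W_j(a,b;p,q)$ is defined by $W_0=a$, $W_1=b$, $W_j=pW_{j-1}-qW_{j-2}$ for $j\ge2$, and extended to negative indices by $W_{j}=(pW_{j+1}-W_{j+2})/q$, so the recurrence holds for all integers $j$. $U_j=W_j(0,1;p,q)$ is the Lucas sequence of the first kind (same $p,q$). The left side is an iterated sum with $n$ summation signs: $a_{n-1}$ runs from $c$ to $a_n$, and for each $i$ the index $a_{i-1}$ runs from $c$ to $a_i$. Summation convention: for integers $m,M$, $\sum_{k=m}^{M}h(k)$ is the usual sum if $M\ge m$, equals $0$ if $M=m-1$, and equals $-\sum_{k=M+1}^{m-1}h(k)$ if $M\le m-2$. For an integer $N$ and a non-negative integer $j$, $\binom{N}{j}=N(N-1)\cdots(N-j+1)/j!$. -}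

module Defs where

open import Level using (Level; _⊔_)
open import Algebra.Bundles using (CommutativeRing)
open import Data.Nat as ℕ using (ℕ; zero; suc)
open import Data.Nat.Properties using (_!≢0)
open import Data.Integer as ℤ using (ℤ; +_; -[1+_])
open import Data.Integer.Base using (_/ℕ_)
open import Data.Product using (_×_; _,_; proj₁)
open import Relation.Nullary using (¬_)

-- A field: a commutative ring with 0 ≠ 1 in which every nonzero
-- element has a multiplicative inverse (the inverse operation is total;
-- its value at 0 is irrelevant).  Used in place of ℂ.
record Field (c ℓ : Level) : Set (Level.suc (c ⊔ ℓ)) where
  field
    commutativeRing : CommutativeRing c ℓ
  open CommutativeRing commutativeRing public
  field
    _⁻¹      : Carrier → Carrier
    0≉1      : ¬ (0# ≈ 1#)
    ⁻¹-inverse : ∀ x → ¬ (x ≈ 0#) → (x * (x ⁻¹)) ≈ 1#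

module FieldOps {c ℓ : Level} (K : Field c ℓ) where
  open Field K

  pow : Carrier → ℕ → Carrier
  pow x zero    = 1#
  pow x (suc n) = x * pow x n

  zpow : Carrier → ℤ → Carrier
  zpow x (+ n)      = pow x n
  zpow x -[1+ n ]   = pow (x ⁻¹) (suc n)

  fromℕ : ℕ → Carrier
  fromℕ zero    = 0#
  fromℕ (suc n) = 1# + fromℕ n

  fromℤ : ℤ → Carrier
  fromℤ (+ n)     = fromℕ n
  fromℤ -[1+ n ]  = - fromℕ (suc n)

  -- Horadam sequence W_j(a,b;p,q) for all integers j.
  -- forward pair (W_n , W_{n+1}) for n : ℕ
  Wfwd : Carrier → Carrier → Carrier → Carrier → ℕ → Carrier × Carrier
  Wfwd a b p q zero    = a , b
  Wfwd a b p q (suc n) with Wfwd a b p q n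
  ... | (x , y) = y , (p * y - q * x)

  -- backward pair (W_{-n} , W_{-n+1}) for n : ℕ,
  -- using W_j = (p W_{j+1} - W_{j+2}) / q
  Wbwd : Carrier → Carrier → Carrier → Carrier → ℕ → Carrier × Carrier
  Wbwd a b p q zero    = a , b
  Wbwd a b p q (suc n) with Wbwd a b p q n
  ... | (x , y) = ((p * x - y) * (q ⁻¹)) , x

  W : Carrier → Carrier → Carrier → Carrier → ℤ → Carrier
  W a b p q (+ n)      = proj₁ (Wfwd a b p q n)
  W a b p q -[1+ n ]   = proj₁ (Wbwd a b p q (suc n))

  U : Carrier → Carrier → ℤ → Carrier
  U p q = W 0# 1# p q

  sumLen : ℤ → ℕ → (ℤ → Carrier) → Carrier
  sumLen m zero    h = 0#
  sumLen m (suc k) h = h m + sumLen (m ℤ.+ ℤ.1ℤ) k h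

  -- Σ_{k=m}^{M} h(k) with the paper's convention:
  --   usual sum if M ≥ m; 0 if M = m-1; -Σ_{k=M+1}^{m-1} h(k) if M ≤ m-2
  sumZ : ℤ → ℤ → (ℤ → Carrier) → Carrier
  sumZ m M h with M ℤ.- m ℤ.+ ℤ.1ℤ
  ... | + len      = sumLen m len h
  ... | -[1+ k ]   = - sumLen (M ℤ.+ ℤ.1ℤ) (suc k) h

  sumNat : ℕ → (ℕ → Carrier) → Carrier
  sumNat zero    f = 0#
  sumNat (suc n) f = sumNat n f + f n

  iterSum : ℤ → (ℤ → Carrier) → ℕ → ℤ → Carrier
  iterSum c f zero    x = f x
  iterSum c f (suc k) x = sumZ c x (iterSum c f k)

fallingℤ : ℤ → ℕ → ℤ
fallingℤ N zero    = ℤ.1ℤ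
fallingℤ N (suc j) = fallingℤ N j ℤ.* (N ℤ.- + j)

binomℤ : ℤ → ℕ → ℤ
binomℤ N j = (fallingℤ N j /ℕ (j ℕ.!)) {{j !≢0}}

{-# OPTIONS --safe #-}
-- Write x = U_d / U_{r+d} and ρ = - U_d / (q^d U_r).  Read as a function F_n(a) of the
-- upper limit a, the right-hand side satisfies F_0(a) = x^a W_{ra+s}, F_{n+1}(c-1) = 0 and
-- F_{n+1}(a) - F_{n+1}(a-1) = F_n(a).  Under the paper's summation convention a sum
-- Σ_{k=c}^{a} (G k - G (k-1)) telescopes to G a - G (c-1) for every integer a, so induction
-- on n gives the theorem.  The difference identity splits into Pascal's rule for the
-- binomial coefficients and ρ (x W_{m+r+d} - W_{m+d}) = x W_m, i.e. into
-- U_{r+d} W_{m+d} - U_d W_{m+d+r} = q^d U_r W_m.  As functions of r both sides of the latter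
-- satisfy the Horadam recurrence, so it suffices to check r = 0 and r = 1, and r = 1 is the
-- Casoratian identity U_{d+1} W_{m+d} - U_d W_{m+d+1} = q^d W_m.

module Submission where

open import Defs
open import Level using (Level)
open import Data.Nat as ℕ using (ℕ; zero; suc)
open import Data.Nat.Properties using (_!≢0)
import Data.Nat.Properties as ℕₚ
import Data.Nat.DivMod as ℕ
open import Data.Integer as ℤ using (ℤ; +_; -[1+_]; 0ℤ; 1ℤ)
open import Data.Integer.Base using (_/ℕ_)
import Data.Integer.Properties as ℤₚ
open import Data.Integer.Tactic.RingSolver using (solve-∀)
open import Data.Maybe using (Maybe; just; nothing)
open import Data.Product using (Σ; _×_; _,_; proj₁)
open import Relation.Nullary using (¬_; yes; no)
open import Relation.Binary.PropositionalEquality as ≡ using (_≡_)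
open import Algebra.Solver.Ring.AlmostCommutativeRing
  using (_-Raw-AlmostCommutative⟶_; fromCommutativeRing)

ℤ-induction : ∀ {ℓ} (P : ℤ → Set ℓ) → P 0ℤ →
              (∀ k → P k → P (k ℤ.+ 1ℤ)) → (∀ k → P k → P (k ℤ.- 1ℤ)) →
              ∀ k → P k
ℤ-induction P P0 up down (+ zero)       = P0
ℤ-induction P P0 up down (+ suc n)      =
  ≡.subst P (≡.cong +_ (ℕₚ.+-comm n 1)) (up (+ n) (ℤ-induction P P0 up down (+ n)))
ℤ-induction P P0 up down -[1+ zero ]    = down 0ℤ P0
ℤ-induction P P0 up down -[1+ suc n ]   =
  ≡.subst P (≡.cong (λ m → -[1+ suc m ]) (ℕₚ.+-identityʳ n))
    (down -[1+ n ] (ℤ-induction P P0 up down -[1+ n ]))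

[i*d]/ℕd≡i : ∀ i d .{{_ : ℕ.NonZero d}} → (i ℤ.* + d) /ℕ d ≡ i
[i*d]/ℕd≡i (+ n)    (suc d) =
  ≡.trans (≡.cong (λ z → z /ℕ suc d) (≡.sym (ℤₚ.pos-* n (suc d))))
          (≡.cong +_ (ℕ.m*n/n≡m n (suc d)))
[i*d]/ℕd≡i -[1+ n ] (suc d)
  rewrite ℕ.m*n%n≡0 (suc n) (suc d) {{_}} | ℕ.m*n/n≡m (suc n) (suc d) {{_}} = ≡.refl

Multiple : ℤ → ℤ → Set
Multiple m z = Σ ℤ λ t → z ≡ t ℤ.* m

multiple-from-differences : ∀ m (g : ℤ → ℤ) → Multiple m (g 0ℤ) →
                            (∀ N → Multiple m (g (N ℤ.+ 1ℤ) ℤ.- g N)) →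
                            ∀ N → Multiple m (g N)
multiple-from-differences m g g₀ Δ = ℤ-induction (λ N → Multiple m (g N)) g₀ up down
  where
  open ≡.≡-Reasoning
  up : ∀ N → Multiple m (g N) → Multiple m (g (N ℤ.+ 1ℤ))
  up N (t , gN) with Δ N
  ... | (u , ΔN) = t ℤ.+ u , (begin
    g (N ℤ.+ 1ℤ)                     ≡⟨ split (g (N ℤ.+ 1ℤ)) (g N) ⟩
    g N ℤ.+ (g (N ℤ.+ 1ℤ) ℤ.- g N)  ≡⟨ ≡.cong₂ ℤ._+_ gN ΔN ⟩
    t ℤ.* m ℤ.+ u ℤ.* m              ≡⟨ ℤₚ.*-distribʳ-+ m t u ⟨
    (t ℤ.+ u) ℤ.* m                  ∎)
    where split : ∀ x y → x ≡ y ℤ.+ (x ℤ.- y)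
          split = solve-∀
  down : ∀ N → Multiple m (g N) → Multiple m (g (N ℤ.- 1ℤ))
  down N (t , gN) with Δ (N ℤ.- 1ℤ)
  ... | (u , ΔN) = t ℤ.- u , (begin
    g (N ℤ.- 1ℤ)                                 ≡⟨ split (g (N ℤ.- 1ℤ)) (g N′) ⟩
    g N′ ℤ.- (g N′ ℤ.- g (N ℤ.- 1ℤ))             ≡⟨ ≡.cong (λ z → g z ℤ.- (g N′ ℤ.- g (N ℤ.- 1ℤ))) (pred-suc N) ⟩
    g N ℤ.- (g N′ ℤ.- g (N ℤ.- 1ℤ))              ≡⟨ ≡.cong₂ ℤ._-_ gN ΔN ⟩
    t ℤ.* m ℤ.- u ℤ.* m                          ≡⟨ factor t u m ⟩
    (t ℤ.- u) ℤ.* m                              ∎)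
    where N′ = N ℤ.- 1ℤ ℤ.+ 1ℤ
          split : ∀ x y → x ≡ y ℤ.- (y ℤ.- x)
          split = solve-∀
          pred-suc : ∀ N → N ℤ.- 1ℤ ℤ.+ 1ℤ ≡ N
          pred-suc = solve-∀
          factor : ∀ t u m → t ℤ.* m ℤ.- u ℤ.* m ≡ (t ℤ.- u) ℤ.* m
          factor = solve-∀

fallingℤ-pascal : ∀ N j → fallingℤ (N ℤ.+ 1ℤ) (suc j) ≡
                          fallingℤ N (suc j) ℤ.+ + suc j ℤ.* fallingℤ N j
fallingℤ-pascal N j = ≡.trans (shift j) (distribute N (fallingℤ N j) (+ j))
  where
  distribute : ∀ N f i → (N ℤ.+ 1ℤ) ℤ.* f ≡ f ℤ.* (N ℤ.- i) ℤ.+ (1ℤ ℤ.+ i) ℤ.* f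
  distribute = solve-∀
  shift : ∀ j → fallingℤ (N ℤ.+ 1ℤ) (suc j) ≡ (N ℤ.+ 1ℤ) ℤ.* fallingℤ N j
  shift zero    = base N
    where base : ∀ N → 1ℤ ℤ.* (N ℤ.+ 1ℤ ℤ.- 0ℤ) ≡ (N ℤ.+ 1ℤ) ℤ.* 1ℤ
          base = solve-∀
  shift (suc j) = ≡.trans (≡.cong (ℤ._* (N ℤ.+ 1ℤ ℤ.- (1ℤ ℤ.+ + j))) (shift j))
                          (step N (fallingℤ N j) (+ j))
    where step : ∀ N f i → (N ℤ.+ 1ℤ) ℤ.* f ℤ.* (N ℤ.+ 1ℤ ℤ.- (1ℤ ℤ.+ i)) ≡
                           (N ℤ.+ 1ℤ) ℤ.* (f ℤ.* (N ℤ.- i))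
          step = solve-∀

fallingℤ-zero : ∀ j → fallingℤ 0ℤ (suc j) ≡ 0ℤ
fallingℤ-zero zero    = ≡.refl
fallingℤ-zero (suc j) = ≡.cong (ℤ._* (0ℤ ℤ.- + suc j)) (fallingℤ-zero j)

fallingℤ-multiple : ∀ j N → Multiple (+ (j ℕ.!)) (fallingℤ N j)
fallingℤ-multiple zero    N = 1ℤ , ≡.refl
fallingℤ-multiple (suc j)   =
  multiple-from-differences _ (λ N → fallingℤ N (suc j)) (0ℤ , fallingℤ-zero j) Δ
  where
  open ≡.≡-Reasoning
  Δ : ∀ N → Multiple (+ (suc j ℕ.!)) (fallingℤ (N ℤ.+ 1ℤ) (suc j) ℤ.- fallingℤ N (suc j))
  Δ N with fallingℤ-multiple j N
  ... | (t , FN) = t , (begin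
    fallingℤ (N ℤ.+ 1ℤ) (suc j) ℤ.- fallingℤ N (suc j)
      ≡⟨ ≡.cong (ℤ._- fallingℤ N (suc j)) (fallingℤ-pascal N j) ⟩
    fallingℤ N (suc j) ℤ.+ + suc j ℤ.* fallingℤ N j ℤ.- fallingℤ N (suc j)
      ≡⟨ cancel (fallingℤ N (suc j)) _ ⟩
    + suc j ℤ.* fallingℤ N j    ≡⟨ ≡.cong (+ suc j ℤ.*_) FN ⟩
    + suc j ℤ.* (t ℤ.* + (j ℕ.!)) ≡⟨ swap (+ suc j) t _ ⟩
    t ℤ.* (+ suc j ℤ.* + (j ℕ.!)) ≡⟨ ≡.cong (t ℤ.*_) (ℤₚ.pos-* (suc j) (j ℕ.!)) ⟨
    t ℤ.* + (suc j ℕ.!)           ∎)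
    where cancel : ∀ x y → x ℤ.+ y ℤ.- x ≡ y
          cancel = solve-∀
          swap : ∀ a t f → a ℤ.* (t ℤ.* f) ≡ t ℤ.* (a ℤ.* f)
          swap = solve-∀

fallingℤ≡binomℤ*! : ∀ N j → fallingℤ N j ≡ binomℤ N j ℤ.* + (j ℕ.!)
fallingℤ≡binomℤ*! N j with fallingℤ-multiple j N
... | (t , FN) = ≡.trans FN (≡.cong (ℤ._* + (j ℕ.!)) (≡.sym t≡binom))
  where t≡binom : binomℤ N j ≡ t
        t≡binom = ≡.trans (≡.cong (λ z → (z /ℕ (j ℕ.!)) {{j !≢0}}) FN)
                          ([i*d]/ℕd≡i t (j ℕ.!) {{j !≢0}})

binomℤ-pascal : ∀ N j → binomℤ (N ℤ.+ 1ℤ) (suc j) ≡ binomℤ N (suc j) ℤ.+ binomℤ N j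
binomℤ-pascal N j =
  ≡.trans (≡.cong (λ z → (z /ℕ (suc j ℕ.!)) {{suc j !≢0}}) falling)
          ([i*d]/ℕd≡i (binomℤ N (suc j) ℤ.+ binomℤ N j) (suc j ℕ.!) {{suc j !≢0}})
  where
  open ≡.≡-Reasoning
  collect : ∀ b b′ a f → b ℤ.* (a ℤ.* f) ℤ.+ a ℤ.* (b′ ℤ.* f) ≡ (b ℤ.+ b′) ℤ.* (a ℤ.* f)
  collect = solve-∀
  falling : fallingℤ (N ℤ.+ 1ℤ) (suc j) ≡ (binomℤ N (suc j) ℤ.+ binomℤ N j) ℤ.* + (suc j ℕ.!)
  falling = begin
    fallingℤ (N ℤ.+ 1ℤ) (suc j)
      ≡⟨ fallingℤ-pascal N j ⟩
    fallingℤ N (suc j) ℤ.+ + suc j ℤ.* fallingℤ N j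
      ≡⟨ ≡.cong₂ (λ u v → u ℤ.+ + suc j ℤ.* v) (fallingℤ≡binomℤ*! N (suc j)) (fallingℤ≡binomℤ*! N j) ⟩
    binomℤ N (suc j) ℤ.* + (suc j ℕ.!) ℤ.+ + suc j ℤ.* (binomℤ N j ℤ.* + (j ℕ.!))
      ≡⟨ ≡.cong (λ z → binomℤ N (suc j) ℤ.* z ℤ.+ + suc j ℤ.* (binomℤ N j ℤ.* + (j ℕ.!))) (ℤₚ.pos-* (suc j) (j ℕ.!)) ⟩
    binomℤ N (suc j) ℤ.* (+ suc j ℤ.* + (j ℕ.!)) ℤ.+ + suc j ℤ.* (binomℤ N j ℤ.* + (j ℕ.!))
      ≡⟨ collect (binomℤ N (suc j)) (binomℤ N j) (+ suc j) (+ (j ℕ.!)) ⟩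
    (binomℤ N (suc j) ℤ.+ binomℤ N j) ℤ.* (+ suc j ℤ.* + (j ℕ.!))
      ≡⟨ ≡.cong ((binomℤ N (suc j) ℤ.+ binomℤ N j) ℤ.*_) (ℤₚ.pos-* (suc j) (j ℕ.!)) ⟨
    (binomℤ N (suc j) ℤ.+ binomℤ N j) ℤ.* + (suc j ℕ.!) ∎

binomℤ-n-suc-n : ∀ j → binomℤ (+ j) (suc j) ≡ 0ℤ
binomℤ-n-suc-n j =
  ≡.trans (≡.cong (λ z → (z /ℕ (suc j ℕ.!)) {{suc j !≢0}}) falling≡0)
          (≡.cong +_ (ℕ.0/n≡0 (suc j ℕ.!) {{suc j !≢0}}))
  where falling≡0 : fallingℤ (+ j) (suc j) ≡ 0ℤ
        falling≡0 = ≡.trans (≡.cong (fallingℤ (+ j) j ℤ.*_) (ℤₚ.+-inverseʳ (+ j)))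
                            (ℤₚ.*-zeroʳ (fallingℤ (+ j) j))

module FieldLemmas {ℓ₁ ℓ₂ : Level} (K : Field ℓ₁ ℓ₂) where
  open Field K
  open FieldOps K
  open import Relation.Binary.Reasoning.Setoid setoid
  open import Algebra.Properties.Ring ring using (-‿involutive; -0#≈0#; x[y-z]≈xy-xz)
  open import Algebra.Properties.Group +-group using (//-rightDividesˡ; //-rightDividesʳ)
  open import Algebra.Properties.AbelianGroup +-abelianGroup using (⁻¹-∙-comm)

  1≉0 : ¬ (1# ≈ 0#)
  1≉0 1≈0 = 0≉1 (sym 1≈0)

  fromℕ-suc : ∀ n → fromℕ (n ℕ.+ 1) ≈ fromℕ n + 1#
  fromℕ-suc zero    = +-comm 1# 0#
  fromℕ-suc (suc n) = trans (+-cong refl (fromℕ-suc n)) (sym (+-assoc 1# (fromℕ n) 1#))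

  fromℤ-suc : ∀ u → fromℤ (u ℤ.+ 1ℤ) ≈ fromℤ u + 1#
  fromℤ-suc (+ n)           = fromℕ-suc n
  fromℤ-suc -[1+ zero ]     = sym (trans (+-cong (-‿cong (+-identityʳ 1#)) refl) (-‿inverseˡ 1#))
  fromℤ-suc -[1+ suc n ]    = begin
    - fromℕ (suc n)                      ≈⟨ //-rightDividesˡ 1# (- fromℕ (suc n)) ⟨
    - fromℕ (suc n) - 1# + 1#            ≈⟨ +-cong (+-comm _ _) refl ⟩
    - 1# - fromℕ (suc n) + 1#            ≈⟨ +-cong (⁻¹-∙-comm 1# (fromℕ (suc n))) refl ⟩
    - fromℕ (suc (suc n)) + 1#           ∎

  fromℤ-pred : ∀ u → fromℤ (u ℤ.- 1ℤ) ≈ fromℤ u - 1#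
  fromℤ-pred u = begin
    fromℤ (u ℤ.- 1ℤ)                 ≈⟨ //-rightDividesʳ 1# _ ⟨
    fromℤ (u ℤ.- 1ℤ) + 1# - 1#       ≈⟨ +-cong (fromℤ-suc (u ℤ.- 1ℤ)) refl ⟨
    fromℤ (u ℤ.- 1ℤ ℤ.+ 1ℤ) - 1#     ≡⟨ ≡.cong (λ z → fromℤ z - 1#) (pred-suc u) ⟩
    fromℤ u - 1#                     ∎
    where pred-suc : ∀ u → u ℤ.- 1ℤ ℤ.+ 1ℤ ≡ u
          pred-suc = solve-∀

  fromℤ-+ : ∀ u v → fromℤ (u ℤ.+ v) ≈ fromℤ u + fromℤ v
  fromℤ-+ u = ℤ-induction (λ v → fromℤ (u ℤ.+ v) ≈ fromℤ u + fromℤ v) base up down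
    where
    base : fromℤ (u ℤ.+ 0ℤ) ≈ fromℤ u + 0#
    base = trans (reflexive (≡.cong fromℤ (ℤₚ.+-identityʳ u))) (sym (+-identityʳ _))
    up : ∀ v → fromℤ (u ℤ.+ v) ≈ fromℤ u + fromℤ v → fromℤ (u ℤ.+ (v ℤ.+ 1ℤ)) ≈ fromℤ u + fromℤ (v ℤ.+ 1ℤ)
    up v ih = begin
      fromℤ (u ℤ.+ (v ℤ.+ 1ℤ)) ≡⟨ ≡.cong fromℤ (ℤₚ.+-assoc u v 1ℤ) ⟨
      fromℤ (u ℤ.+ v ℤ.+ 1ℤ)   ≈⟨ fromℤ-suc (u ℤ.+ v) ⟩
      fromℤ (u ℤ.+ v) + 1#     ≈⟨ +-cong ih refl ⟩
      fromℤ u + fromℤ v + 1#   ≈⟨ +-assoc _ _ _ ⟩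
      fromℤ u + (fromℤ v + 1#) ≈⟨ +-cong refl (fromℤ-suc v) ⟨
      fromℤ u + fromℤ (v ℤ.+ 1ℤ) ∎
    down : ∀ v → fromℤ (u ℤ.+ v) ≈ fromℤ u + fromℤ v → fromℤ (u ℤ.+ (v ℤ.- 1ℤ)) ≈ fromℤ u + fromℤ (v ℤ.- 1ℤ)
    down v ih = begin
      fromℤ (u ℤ.+ (v ℤ.- 1ℤ)) ≡⟨ ≡.cong fromℤ (ℤₚ.+-assoc u v ℤ.-1ℤ) ⟨
      fromℤ (u ℤ.+ v ℤ.- 1ℤ)   ≈⟨ fromℤ-pred (u ℤ.+ v) ⟩
      fromℤ (u ℤ.+ v) - 1#     ≈⟨ +-cong ih refl ⟩
      fromℤ u + fromℤ v - 1#   ≈⟨ +-assoc _ _ _ ⟩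
      fromℤ u + (fromℤ v - 1#) ≈⟨ +-cong refl (fromℤ-pred v) ⟨
      fromℤ u + fromℤ (v ℤ.- 1ℤ) ∎

  fromℤ-neg : ∀ u → fromℤ (ℤ.- u) ≈ - fromℤ u
  fromℤ-neg (+ zero)  = sym -0#≈0#
  fromℤ-neg (+ suc n) = refl
  fromℤ-neg -[1+ n ]  = sym (-‿involutive _)

  fromℤ-* : ∀ u v → fromℤ (u ℤ.* v) ≈ fromℤ u * fromℤ v
  fromℤ-* u = ℤ-induction (λ v → fromℤ (u ℤ.* v) ≈ fromℤ u * fromℤ v) base up down
    where
    base : fromℤ (u ℤ.* 0ℤ) ≈ fromℤ u * 0#
    base = trans (reflexive (≡.cong fromℤ (ℤₚ.*-zeroʳ u))) (sym (zeroʳ _))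
    up : ∀ v → fromℤ (u ℤ.* v) ≈ fromℤ u * fromℤ v → fromℤ (u ℤ.* (v ℤ.+ 1ℤ)) ≈ fromℤ u * fromℤ (v ℤ.+ 1ℤ)
    up v ih = begin
      fromℤ (u ℤ.* (v ℤ.+ 1ℤ))          ≡⟨ ≡.cong fromℤ (expand u v) ⟩
      fromℤ (u ℤ.* v ℤ.+ u)             ≈⟨ fromℤ-+ (u ℤ.* v) u ⟩
      fromℤ (u ℤ.* v) + fromℤ u         ≈⟨ +-cong ih (sym (*-identityʳ _)) ⟩
      fromℤ u * fromℤ v + fromℤ u * 1#  ≈⟨ distribˡ _ _ _ ⟨
      fromℤ u * (fromℤ v + 1#)          ≈⟨ *-cong refl (fromℤ-suc v) ⟨
      fromℤ u * fromℤ (v ℤ.+ 1ℤ)        ∎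
      where expand : ∀ u v → u ℤ.* (v ℤ.+ 1ℤ) ≡ u ℤ.* v ℤ.+ u
            expand = solve-∀
    down : ∀ v → fromℤ (u ℤ.* v) ≈ fromℤ u * fromℤ v → fromℤ (u ℤ.* (v ℤ.- 1ℤ)) ≈ fromℤ u * fromℤ (v ℤ.- 1ℤ)
    down v ih = begin
      fromℤ (u ℤ.* (v ℤ.- 1ℤ))          ≡⟨ ≡.cong fromℤ (expand u v) ⟩
      fromℤ (u ℤ.* v ℤ.+ ℤ.- u)         ≈⟨ fromℤ-+ (u ℤ.* v) (ℤ.- u) ⟩
      fromℤ (u ℤ.* v) + fromℤ (ℤ.- u)   ≈⟨ +-cong ih (fromℤ-neg u) ⟩
      fromℤ u * fromℤ v - fromℤ u       ≈⟨ +-cong refl (-‿cong (*-identityʳ _)) ⟨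
      fromℤ u * fromℤ v - fromℤ u * 1#  ≈⟨ x[y-z]≈xy-xz _ _ _ ⟨
      fromℤ u * (fromℤ v - 1#)          ≈⟨ *-cong refl (fromℤ-pred v) ⟨
      fromℤ u * fromℤ (v ℤ.- 1ℤ)        ∎
      where expand : ∀ u v → u ℤ.* (v ℤ.- 1ℤ) ≡ u ℤ.* v ℤ.+ ℤ.- u
            expand = solve-∀

  fromℤ-homomorphism : ℤ.+-*-rawRing -Raw-AlmostCommutative⟶ fromCommutativeRing commutativeRing
  fromℤ-homomorphism = record
    { ⟦_⟧    = fromℤ
    ; +-homo = fromℤ-+
    ; *-homo = fromℤ-*
    ; -‿homo = fromℤ-neg
    ; 0-homo = refl
    ; 1-homo = +-identityʳ 1#
    }

  fromℤ-≟ : ∀ u v → Maybe (fromℤ u ≈ fromℤ v)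
  fromℤ-≟ u v with u ℤ.≟ v
  ... | yes u≡v = just (reflexive (≡.cong fromℤ u≡v))
  ... | no  _   = nothing

  open import Algebra.Solver.Ring ℤ.+-*-rawRing (fromCommutativeRing commutativeRing)
    fromℤ-homomorphism fromℤ-≟ public
    using (solve; _:=_; _:+_; _:*_; :-_; _:-_; con)

  ⁻¹-inverseˡ : ∀ {x} → ¬ (x ≈ 0#) → x ⁻¹ * x ≈ 1#
  ⁻¹-inverseˡ {x} x≉0 = trans (*-comm (x ⁻¹) x) (⁻¹-inverse x x≉0)

  *-cancelˡ : ∀ {x y z} → ¬ (x ≈ 0#) → x * y ≈ x * z → y ≈ z
  *-cancelˡ {x} {y} {z} x≉0 xy≈xz = begin
    y              ≈⟨ undo y ⟨
    x ⁻¹ * (x * y) ≈⟨ *-cong refl xy≈xz ⟩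
    x ⁻¹ * (x * z) ≈⟨ undo z ⟩
    z              ∎
    where undo : ∀ w → x ⁻¹ * (x * w) ≈ w
          undo w = trans (sym (*-assoc _ _ _)) (trans (*-cong (⁻¹-inverseˡ x≉0) refl) (*-identityˡ w))

  *-nonzero : ∀ {x y} → ¬ (x ≈ 0#) → ¬ (y ≈ 0#) → ¬ (x * y ≈ 0#)
  *-nonzero x≉0 y≉0 xy≈0 = y≉0 (*-cancelˡ x≉0 (trans xy≈0 (sym (zeroʳ _))))

  ⁻¹-unique : ∀ {x y} → ¬ (x ≈ 0#) → x * y ≈ 1# → y ≈ x ⁻¹
  ⁻¹-unique {x} x≉0 xy≈1 = *-cancelˡ x≉0 (trans xy≈1 (sym (⁻¹-inverse x x≉0)))

  ⁻¹-nonzero : ∀ {x} → ¬ (x ≈ 0#) → ¬ (x ⁻¹ ≈ 0#)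
  ⁻¹-nonzero {x} x≉0 x⁻¹≈0 =
    1≉0 (trans (sym (⁻¹-inverse x x≉0)) (trans (*-cong refl x⁻¹≈0) (zeroʳ x)))

  ⁻¹-cong : ∀ {x y} → ¬ (x ≈ 0#) → x ≈ y → x ⁻¹ ≈ y ⁻¹
  ⁻¹-cong {x} x≉0 x≈y =
    ⁻¹-unique (λ y≈0 → x≉0 (trans x≈y y≈0)) (trans (*-cong (sym x≈y) refl) (⁻¹-inverse x x≉0))

  ⁻¹-distrib-* : ∀ {x y} → ¬ (x ≈ 0#) → ¬ (y ≈ 0#) → (x * y) ⁻¹ ≈ x ⁻¹ * y ⁻¹
  ⁻¹-distrib-* {x} {y} x≉0 y≉0 = sym (⁻¹-unique (*-nonzero x≉0 y≉0) (begin
    x * y * (x ⁻¹ * y ⁻¹)   ≈⟨ solve 4 (λ x y x′ y′ → x :* y :* (x′ :* y′) := (x :* x′) :* (y :* y′)) refl x y (x ⁻¹) (y ⁻¹) ⟩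
    (x * x ⁻¹) * (y * y ⁻¹) ≈⟨ *-cong (⁻¹-inverse x x≉0) (⁻¹-inverse y y≉0) ⟩
    1# * 1#                 ≈⟨ *-identityˡ 1# ⟩
    1#                      ∎))

  ⁻¹-involutive : ∀ {x} → ¬ (x ≈ 0#) → (x ⁻¹) ⁻¹ ≈ x
  ⁻¹-involutive x≉0 = sym (⁻¹-unique (⁻¹-nonzero x≉0) (⁻¹-inverseˡ x≉0))

  1⁻¹≈1 : 1# ⁻¹ ≈ 1#
  1⁻¹≈1 = sym (⁻¹-unique 1≉0 (*-identityˡ 1#))

  pow-cong : ∀ {x y} n → x ≈ y → pow x n ≈ pow y n
  pow-cong zero    x≈y = refl
  pow-cong (suc n) x≈y = *-cong x≈y (pow-cong n x≈y)

  pow-nonzero : ∀ {x} n → ¬ (x ≈ 0#) → ¬ (pow x n ≈ 0#)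
  pow-nonzero zero    x≉0 = 1≉0
  pow-nonzero (suc n) x≉0 = *-nonzero x≉0 (pow-nonzero n x≉0)

  pow-distrib-* : ∀ x y n → pow (x * y) n ≈ pow x n * pow y n
  pow-distrib-* x y zero    = sym (*-identityˡ 1#)
  pow-distrib-* x y (suc n) = trans (*-cong refl (pow-distrib-* x y n))
    (solve 4 (λ x y a b → x :* y :* (a :* b) := (x :* a) :* (y :* b)) refl x y (pow x n) (pow y n))

  pow-homo-+ : ∀ x m n → pow x (m ℕ.+ n) ≈ pow x m * pow x n
  pow-homo-+ x zero    n = sym (*-identityˡ (pow x n))
  pow-homo-+ x (suc m) n = trans (*-cong refl (pow-homo-+ x m n)) (sym (*-assoc x (pow x m) (pow x n)))

  pow-⁻¹ : ∀ {x} n → ¬ (x ≈ 0#) → pow (x ⁻¹) n ≈ pow x n ⁻¹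
  pow-⁻¹ zero    x≉0 = sym 1⁻¹≈1
  pow-⁻¹ (suc n) x≉0 = trans (*-cong refl (pow-⁻¹ n x≉0)) (sym (⁻¹-distrib-* x≉0 (pow-nonzero n x≉0)))

  zpow-nonzero : ∀ {x} k → ¬ (x ≈ 0#) → ¬ (zpow x k ≈ 0#)
  zpow-nonzero (+ n)    x≉0 = pow-nonzero n x≉0
  zpow-nonzero -[1+ n ] x≉0 = pow-nonzero (suc n) (⁻¹-nonzero x≉0)

  zpow-suc : ∀ {x} → ¬ (x ≈ 0#) → ∀ k → zpow x (k ℤ.+ 1ℤ) ≈ zpow x k * x
  zpow-suc {x} x≉0 (+ n)          = trans (pow-homo-+ x n 1) (*-cong refl (*-identityʳ x))
  zpow-suc {x} x≉0 -[1+ zero ]    = sym (trans (*-cong (*-identityʳ (x ⁻¹)) refl) (⁻¹-inverseˡ x≉0))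
  zpow-suc {x} x≉0 -[1+ suc n ]   = sym (begin
    x ⁻¹ * (x ⁻¹ * pow (x ⁻¹) n) * x ≈⟨ solve 3 (λ x′ x y → x′ :* y :* x := (x′ :* x) :* y) refl (x ⁻¹) x _ ⟩
    x ⁻¹ * x * (x ⁻¹ * pow (x ⁻¹) n) ≈⟨ *-cong (⁻¹-inverseˡ x≉0) refl ⟩
    1# * (x ⁻¹ * pow (x ⁻¹) n)       ≈⟨ *-identityˡ _ ⟩
    x ⁻¹ * pow (x ⁻¹) n              ∎)

  zpow-pred : ∀ {x} → ¬ (x ≈ 0#) → ∀ k → zpow x k ≈ zpow x (k ℤ.- 1ℤ) * x
  zpow-pred {x} x≉0 k = trans (reflexive (≡.cong (zpow x) (pred-suc k))) (zpow-suc x≉0 (k ℤ.- 1ℤ))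
    where pred-suc : ∀ k → k ≡ k ℤ.- 1ℤ ℤ.+ 1ℤ
          pred-suc = solve-∀

  zpow-homo-+ : ∀ {x} → ¬ (x ≈ 0#) → ∀ k m → zpow x (k ℤ.+ m) ≈ zpow x k * zpow x m
  zpow-homo-+ {x} x≉0 k = ℤ-induction (λ m → zpow x (k ℤ.+ m) ≈ zpow x k * zpow x m) base up down
    where
    base : zpow x (k ℤ.+ 0ℤ) ≈ zpow x k * 1#
    base = trans (reflexive (≡.cong (zpow x) (ℤₚ.+-identityʳ k))) (sym (*-identityʳ _))
    up : ∀ m → zpow x (k ℤ.+ m) ≈ zpow x k * zpow x m →
         zpow x (k ℤ.+ (m ℤ.+ 1ℤ)) ≈ zpow x k * zpow x (m ℤ.+ 1ℤ)
    up m ih = begin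
      zpow x (k ℤ.+ (m ℤ.+ 1ℤ))   ≡⟨ ≡.cong (zpow x) (ℤₚ.+-assoc k m 1ℤ) ⟨
      zpow x (k ℤ.+ m ℤ.+ 1ℤ)     ≈⟨ zpow-suc x≉0 (k ℤ.+ m) ⟩
      zpow x (k ℤ.+ m) * x        ≈⟨ *-cong ih refl ⟩
      zpow x k * zpow x m * x     ≈⟨ *-assoc _ _ _ ⟩
      zpow x k * (zpow x m * x)   ≈⟨ *-cong refl (zpow-suc x≉0 m) ⟨
      zpow x k * zpow x (m ℤ.+ 1ℤ) ∎
    down : ∀ m → zpow x (k ℤ.+ m) ≈ zpow x k * zpow x m →
           zpow x (k ℤ.+ (m ℤ.- 1ℤ)) ≈ zpow x k * zpow x (m ℤ.- 1ℤ)
    down m ih = *-cancelˡ x≉0 (begin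
      x * zpow x (k ℤ.+ (m ℤ.- 1ℤ))     ≡⟨ ≡.cong (λ i → x * zpow x i) (ℤₚ.+-assoc k m ℤ.-1ℤ) ⟨
      x * zpow x (k ℤ.+ m ℤ.- 1ℤ)       ≈⟨ *-comm _ _ ⟩
      zpow x (k ℤ.+ m ℤ.- 1ℤ) * x       ≈⟨ zpow-pred x≉0 (k ℤ.+ m) ⟨
      zpow x (k ℤ.+ m)                  ≈⟨ ih ⟩
      zpow x k * zpow x m               ≈⟨ *-cong refl (zpow-pred x≉0 m) ⟩
      zpow x k * (zpow x (m ℤ.- 1ℤ) * x) ≈⟨ solve 3 (λ a b x → a :* (b :* x) := x :* (a :* b)) refl (zpow x k) _ x ⟩
      x * (zpow x k * zpow x (m ℤ.- 1ℤ)) ∎)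

  zpow-distrib-* : ∀ {x y} → ¬ (x ≈ 0#) → ¬ (y ≈ 0#) → ∀ k → zpow (x * y) k ≈ zpow x k * zpow y k
  zpow-distrib-* {x} {y} x≉0 y≉0 (+ n)    = pow-distrib-* x y n
  zpow-distrib-* {x} {y} x≉0 y≉0 -[1+ n ] =
    trans (pow-cong (suc n) (⁻¹-distrib-* x≉0 y≉0)) (pow-distrib-* (x ⁻¹) (y ⁻¹) (suc n))

  zpow-⁻¹ : ∀ {x} → ¬ (x ≈ 0#) → ∀ k → zpow (x ⁻¹) k ≈ zpow x k ⁻¹
  zpow-⁻¹ x≉0 (+ n)    = pow-⁻¹ n x≉0
  zpow-⁻¹ {x} x≉0 -[1+ n ] = begin
    pow ((x ⁻¹) ⁻¹) (suc n)     ≈⟨ pow-cong (suc n) (⁻¹-involutive x≉0) ⟩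
    pow x (suc n)               ≈⟨ ⁻¹-involutive (pow-nonzero (suc n) x≉0) ⟨
    (pow x (suc n) ⁻¹) ⁻¹       ≈⟨ ⁻¹-cong (pow-nonzero (suc n) (⁻¹-nonzero x≉0)) (pow-⁻¹ (suc n) x≉0) ⟨
    pow (x ⁻¹) (suc n) ⁻¹       ∎

  sumNat-cong : ∀ n {f g : ℕ → Carrier} → (∀ j → f j ≈ g j) → sumNat n f ≈ sumNat n g
  sumNat-cong zero    f≈g = refl
  sumNat-cong (suc n) f≈g = +-cong (sumNat-cong n f≈g) (f≈g n)

  sumNat-zero : ∀ n (f : ℕ → Carrier) → (∀ j → f j ≈ 0#) → sumNat n f ≈ 0#
  sumNat-zero zero    f f≈0 = refl
  sumNat-zero (suc n) f f≈0 = trans (+-cong (sumNat-zero n f f≈0) (f≈0 n)) (+-identityˡ 0#)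

  sumNat-homo-- : ∀ n (f g : ℕ → Carrier) → sumNat n f - sumNat n g ≈ sumNat n (λ j → f j - g j)
  sumNat-homo-- zero    f g = -‿inverseʳ 0#
  sumNat-homo-- (suc n) f g = trans
    (solve 4 (λ a b c d → a :+ b :- (c :+ d) := (a :- c) :+ (b :- d)) refl (sumNat n f) (f n) (sumNat n g) (g n))
    (+-cong (sumNat-homo-- n f g) refl)

  sumNat-suc : ∀ n (f : ℕ → Carrier) → sumNat (suc n) f ≈ f 0 + sumNat n (λ j → f (suc j))
  sumNat-suc zero    f = +-comm 0# (f 0)
  sumNat-suc (suc n) f = trans (+-cong (sumNat-suc n f) refl) (+-assoc _ _ _)

  module _ (G : ℤ → Carrier) {h : ℤ → Carrier} (Δ : ∀ k → h k ≈ G k - G (k ℤ.- 1ℤ)) where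

    sumLen-telescope : ∀ m len → sumLen m len h ≈ G (m ℤ.+ + len ℤ.- 1ℤ) - G (m ℤ.- 1ℤ)
    sumLen-telescope m zero      = begin
      0#                               ≈⟨ -‿inverseʳ (G (m ℤ.- 1ℤ)) ⟨
      G (m ℤ.- 1ℤ) - G (m ℤ.- 1ℤ)       ≡⟨ ≡.cong (λ i → G (i ℤ.- 1ℤ) - G (m ℤ.- 1ℤ)) (ℤₚ.+-identityʳ m) ⟨
      G (m ℤ.+ + 0 ℤ.- 1ℤ) - G (m ℤ.- 1ℤ) ∎
    sumLen-telescope m (suc len) = begin
      h m + sumLen (m ℤ.+ 1ℤ) len h
        ≈⟨ +-cong (Δ m) (sumLen-telescope (m ℤ.+ 1ℤ) len) ⟩
      G m - G (m ℤ.- 1ℤ) + (G (m ℤ.+ 1ℤ ℤ.+ + len ℤ.- 1ℤ) - G (m ℤ.+ 1ℤ ℤ.- 1ℤ))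
        ≡⟨ ≡.cong₂ (λ i i′ → G m - G (m ℤ.- 1ℤ) + (G i - G i′)) (reassoc m (+ len)) (pred-suc m) ⟩
      G m - G (m ℤ.- 1ℤ) + (G (m ℤ.+ + suc len ℤ.- 1ℤ) - G m)
        ≈⟨ solve 3 (λ a b c → a :- b :+ (c :- a) := c :- b) refl _ _ _ ⟩
      G (m ℤ.+ + suc len ℤ.- 1ℤ) - G (m ℤ.- 1ℤ) ∎
      where reassoc : ∀ m l → m ℤ.+ 1ℤ ℤ.+ l ℤ.- 1ℤ ≡ m ℤ.+ (1ℤ ℤ.+ l) ℤ.- 1ℤ
            reassoc = solve-∀
            pred-suc : ∀ m → m ℤ.+ 1ℤ ℤ.- 1ℤ ≡ m
            pred-suc = solve-∀

    sumZ-telescope : ∀ m M → sumZ m M h ≈ G M - G (m ℤ.- 1ℤ)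
    sumZ-telescope m M with M ℤ.- m ℤ.+ 1ℤ in len≡
    ... | + len = begin
      sumLen m len h                                  ≈⟨ sumLen-telescope m len ⟩
      G (m ℤ.+ + len ℤ.- 1ℤ) - G (m ℤ.- 1ℤ)           ≡⟨ ≡.cong (λ l → G (m ℤ.+ l ℤ.- 1ℤ) - G (m ℤ.- 1ℤ)) len≡ ⟨
      G (m ℤ.+ (M ℤ.- m ℤ.+ 1ℤ) ℤ.- 1ℤ) - G (m ℤ.- 1ℤ) ≡⟨ ≡.cong (λ i → G i - G (m ℤ.- 1ℤ)) (upper m M) ⟩
      G M - G (m ℤ.- 1ℤ)                              ∎
      where upper : ∀ m M → m ℤ.+ (M ℤ.- m ℤ.+ 1ℤ) ℤ.- 1ℤ ≡ M
            upper = solve-∀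
    ... | -[1+ k ] = begin
      - sumLen (M ℤ.+ 1ℤ) (suc k) h
        ≈⟨ -‿cong (sumLen-telescope (M ℤ.+ 1ℤ) (suc k)) ⟩
      - (G (M ℤ.+ 1ℤ ℤ.+ ℤ.- -[1+ k ] ℤ.- 1ℤ) - G (M ℤ.+ 1ℤ ℤ.- 1ℤ))
        ≡⟨ ≡.cong₂ (λ l i → - (G (M ℤ.+ 1ℤ ℤ.+ ℤ.- l ℤ.- 1ℤ) - G i)) len≡ (≡.sym (pred-suc M)) ⟨
      - (G (M ℤ.+ 1ℤ ℤ.+ ℤ.- (M ℤ.- m ℤ.+ 1ℤ) ℤ.- 1ℤ) - G M)
        ≡⟨ ≡.cong (λ i → - (G i - G M)) (lower m M) ⟩
      - (G (m ℤ.- 1ℤ) - G M)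
        ≈⟨ solve 2 (λ a b → :- (a :- b) := b :- a) refl _ _ ⟩
      G M - G (m ℤ.- 1ℤ) ∎
      where lower : ∀ m M → M ℤ.+ 1ℤ ℤ.+ ℤ.- (M ℤ.- m ℤ.+ 1ℤ) ℤ.- 1ℤ ≡ m ℤ.- 1ℤ
            lower = solve-∀
            pred-suc : ∀ m → m ℤ.+ 1ℤ ℤ.- 1ℤ ≡ m
            pred-suc = solve-∀

module Recurrence {ℓ₁ ℓ₂ : Level} (K : Field ℓ₁ ℓ₂) (p q : Field.Carrier K)
                  (q≉0 : ¬ (Field._≈_ K q (Field.0# K))) where
  open Field K
  open FieldOps K
  open FieldLemmas K
  open import Relation.Binary.Reasoning.Setoid setoid
  open import Algebra.Properties.Group +-group using (x∙y⁻¹≈ε⇒x≈y)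

  Recurrent : (ℤ → Carrier) → Set ℓ₂
  Recurrent S = ∀ j → S (j ℤ.+ + 2) ≈ p * S (j ℤ.+ 1ℤ) - q * S j

  backward-step : ∀ x y → x ≈ p * y - q * ((p * y - x) * q ⁻¹)
  backward-step x y = sym (begin
    p * y - q * ((p * y - x) * q ⁻¹)  ≈⟨ solve 5 (λ p q y x q′ → p :* y :- q :* ((p :* y :- x) :* q′) := p :* y :- (p :* y :- x) :* (q :* q′)) refl p q y x (q ⁻¹) ⟩
    p * y - (p * y - x) * (q * q ⁻¹)  ≈⟨ +-cong refl (-‿cong (*-cong refl (⁻¹-inverse q q≉0))) ⟩
    p * y - (p * y - x) * 1#          ≈⟨ +-cong refl (-‿cong (*-identityʳ _)) ⟩
    p * y - (p * y - x)               ≈⟨ solve 2 (λ z x → z :- (z :- x) := x) refl (p * y) x ⟩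
    x                                 ∎)

  W-recurrent : ∀ a b → Recurrent (W a b p q)
  W-recurrent a b (+ n)              = begin
    W a b p q (+ (n ℕ.+ 2))         ≡⟨ ≡.cong (λ i → proj₁ (Wfwd a b p q i)) (ℕₚ.+-comm n 2) ⟩
    proj₁ (Wfwd a b p q (2 ℕ.+ n))  ≡⟨ forward n ⟩
    p * proj₁ (Wfwd a b p q (suc n)) - q * W a b p q (+ n)
      ≡⟨ ≡.cong (λ i → p * proj₁ (Wfwd a b p q i) - q * W a b p q (+ n)) (ℕₚ.+-comm 1 n) ⟩
    p * W a b p q (+ (n ℕ.+ 1)) - q * W a b p q (+ n) ∎
    where forward : ∀ n → proj₁ (Wfwd a b p q (2 ℕ.+ n)) ≡
                          p * proj₁ (Wfwd a b p q (suc n)) - q * proj₁ (Wfwd a b p q n)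
          forward n with Wfwd a b p q n
          ... | _ = ≡.refl
  W-recurrent a b -[1+ zero ]        = backward-step b a
  W-recurrent a b -[1+ suc zero ]    = backward-step a ((p * a - b) * q ⁻¹)
  W-recurrent a b -[1+ suc (suc n) ] =
    trans (backward-step (proj₁ (Wbwd a b p q (suc n))) (proj₁ (Wbwd a b p q (2 ℕ.+ n))))
          (reflexive (≡.cong (λ w → p * proj₁ (Wbwd a b p q (2 ℕ.+ n)) - q * w) (≡.sym (backward (suc n)))))
    where backward : ∀ n → proj₁ (Wbwd a b p q (2 ℕ.+ n)) ≡
                           (p * proj₁ (Wbwd a b p q (suc n)) - proj₁ (Wbwd a b p q n)) * q ⁻¹
          backward n with Wbwd a b p q n
          ... | _ = ≡.refl

  U-recurrent : Recurrent (U p q)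
  U-recurrent = W-recurrent 0# 1#

  recurrent-shift : ∀ {S} → Recurrent S → ∀ m → Recurrent (λ n → S (m ℤ.+ n))
  recurrent-shift {S} S-rec m j = begin
    S (m ℤ.+ (j ℤ.+ + 2))                        ≡⟨ ≡.cong S (ℤₚ.+-assoc m j (+ 2)) ⟨
    S (m ℤ.+ j ℤ.+ + 2)                          ≈⟨ S-rec (m ℤ.+ j) ⟩
    p * S (m ℤ.+ j ℤ.+ 1ℤ) - q * S (m ℤ.+ j)     ≡⟨ ≡.cong (λ i → p * S i - q * S (m ℤ.+ j)) (ℤₚ.+-assoc m j 1ℤ) ⟩
    p * S (m ℤ.+ (j ℤ.+ 1ℤ)) - q * S (m ℤ.+ j)   ∎

  recurrent-scale : ∀ {S} → Recurrent S → ∀ k → Recurrent (λ n → S n * k)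
  recurrent-scale {S} S-rec k j = begin
    S (j ℤ.+ + 2) * k                              ≈⟨ *-cong (S-rec j) refl ⟩
    (p * S (j ℤ.+ 1ℤ) - q * S j) * k               ≈⟨ solve 5 (λ p q a b k → (p :* a :- q :* b) :* k := p :* (a :* k) :- q :* (b :* k)) refl p q _ _ k ⟩
    p * (S (j ℤ.+ 1ℤ) * k) - q * (S j * k)         ∎

  recurrent-- : ∀ {S T} → Recurrent S → Recurrent T → Recurrent (λ n → S n - T n)
  recurrent-- {S} {T} S-rec T-rec j = begin
    S (j ℤ.+ + 2) - T (j ℤ.+ + 2)
      ≈⟨ +-cong (S-rec j) (-‿cong (T-rec j)) ⟩
    (p * S (j ℤ.+ 1ℤ) - q * S j) - (p * T (j ℤ.+ 1ℤ) - q * T j)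
      ≈⟨ solve 6 (λ p q a b c d → (p :* a :- q :* b) :- (p :* c :- q :* d) := p :* (a :- c) :- q :* (b :- d)) refl p q _ _ _ _ ⟩
    p * (S (j ℤ.+ 1ℤ) - T (j ℤ.+ 1ℤ)) - q * (S j - T j) ∎

  recurrent-zero : ∀ {S} → Recurrent S → S 0ℤ ≈ 0# → S 1ℤ ≈ 0# → ∀ k → S k ≈ 0#
  recurrent-zero {S} S-rec S0 S1 k =
    proj₁ (ℤ-induction (λ k → S k ≈ 0# × S (k ℤ.+ 1ℤ) ≈ 0#) (S0 , S1) up down k)
    where
    up : ∀ k → S k ≈ 0# × S (k ℤ.+ 1ℤ) ≈ 0# → S (k ℤ.+ 1ℤ) ≈ 0# × S (k ℤ.+ 1ℤ ℤ.+ 1ℤ) ≈ 0#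
    up k (Sk , Sk+1) = Sk+1 , (begin
      S (k ℤ.+ 1ℤ ℤ.+ 1ℤ)            ≡⟨ ≡.cong S (ℤₚ.+-assoc k 1ℤ 1ℤ) ⟩
      S (k ℤ.+ + 2)                  ≈⟨ S-rec k ⟩
      p * S (k ℤ.+ 1ℤ) - q * S k     ≈⟨ +-cong (*-cong refl Sk+1) (-‿cong (*-cong refl Sk)) ⟩
      p * 0# - q * 0#                ≈⟨ solve 2 (λ p q → p :* con 0ℤ :- q :* con 0ℤ := con 0ℤ) refl p q ⟩
      0#                             ∎)
    down : ∀ k → S k ≈ 0# × S (k ℤ.+ 1ℤ) ≈ 0# → S (k ℤ.- 1ℤ) ≈ 0# × S (k ℤ.- 1ℤ ℤ.+ 1ℤ) ≈ 0#
    down k (Sk , Sk+1) = *-cancelˡ q≉0 qS≈q0 , trans (reflexive (≡.cong S (pred-suc k))) Sk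
      where
      pred-suc : ∀ k → k ℤ.- 1ℤ ℤ.+ 1ℤ ≡ k
      pred-suc = solve-∀
      pred+2 : ∀ k → k ℤ.- 1ℤ ℤ.+ + 2 ≡ k ℤ.+ 1ℤ
      pred+2 = solve-∀
      qS≈q0 : q * S (k ℤ.- 1ℤ) ≈ q * 0#
      qS≈q0 = begin
        q * S (k ℤ.- 1ℤ)
          ≈⟨ solve 4 (λ p q y z → q :* z := p :* y :- (p :* y :- q :* z)) refl p q (S (k ℤ.- 1ℤ ℤ.+ 1ℤ)) _ ⟩
        p * S (k ℤ.- 1ℤ ℤ.+ 1ℤ) - (p * S (k ℤ.- 1ℤ ℤ.+ 1ℤ) - q * S (k ℤ.- 1ℤ))
          ≈⟨ +-cong refl (-‿cong (S-rec (k ℤ.- 1ℤ))) ⟨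
        p * S (k ℤ.- 1ℤ ℤ.+ 1ℤ) - S (k ℤ.- 1ℤ ℤ.+ + 2)
          ≡⟨ ≡.cong₂ (λ i i′ → p * S i - S i′) (pred-suc k) (pred+2 k) ⟩
        p * S k - S (k ℤ.+ 1ℤ)
          ≈⟨ +-cong (*-cong refl Sk) (-‿cong Sk+1) ⟩
        p * 0# - 0#
          ≈⟨ solve 2 (λ p q → p :* con 0ℤ :- con 0ℤ := q :* con 0ℤ) refl p q ⟩
        q * 0# ∎

  casoratian : (ℤ → Carrier) → (ℤ → Carrier) → ℤ → Carrier
  casoratian f g k = f (k ℤ.+ 1ℤ) * g k - f k * g (k ℤ.+ 1ℤ)

  module _ {f g : ℤ → Carrier} (f-rec : Recurrent f) (g-rec : Recurrent g) where

    casoratian-suc : ∀ k → casoratian f g (k ℤ.+ 1ℤ) ≈ q * casoratian f g k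
    casoratian-suc k = begin
      f (k ℤ.+ 1ℤ ℤ.+ 1ℤ) * g (k ℤ.+ 1ℤ) - f (k ℤ.+ 1ℤ) * g (k ℤ.+ 1ℤ ℤ.+ 1ℤ)
        ≡⟨ ≡.cong₂ (λ i i′ → f i * g (k ℤ.+ 1ℤ) - f (k ℤ.+ 1ℤ) * g i′) (ℤₚ.+-assoc k 1ℤ 1ℤ) (ℤₚ.+-assoc k 1ℤ 1ℤ) ⟩
      f (k ℤ.+ + 2) * g (k ℤ.+ 1ℤ) - f (k ℤ.+ 1ℤ) * g (k ℤ.+ + 2)
        ≈⟨ +-cong (*-cong (f-rec k) refl) (-‿cong (*-cong refl (g-rec k))) ⟩
      (p * f (k ℤ.+ 1ℤ) - q * f k) * g (k ℤ.+ 1ℤ) - f (k ℤ.+ 1ℤ) * (p * g (k ℤ.+ 1ℤ) - q * g k)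
        ≈⟨ solve 6 (λ p q f₁ f₀ g₁ g₀ → (p :* f₁ :- q :* f₀) :* g₁ :- f₁ :* (p :* g₁ :- q :* g₀) := q :* (f₁ :* g₀ :- f₀ :* g₁)) refl p q _ _ _ _ ⟩
      q * casoratian f g k ∎

    casoratian-zpow : ∀ k → casoratian f g k ≈ zpow q k * casoratian f g 0ℤ
    casoratian-zpow = ℤ-induction (λ k → C k ≈ zpow q k * C 0ℤ) (sym (*-identityˡ _)) up down
      where
      C = casoratian f g
      up : ∀ k → C k ≈ zpow q k * C 0ℤ → C (k ℤ.+ 1ℤ) ≈ zpow q (k ℤ.+ 1ℤ) * C 0ℤ
      up k ih = begin
        C (k ℤ.+ 1ℤ)              ≈⟨ casoratian-suc k ⟩
        q * C k                   ≈⟨ *-cong refl ih ⟩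
        q * (zpow q k * C 0ℤ)     ≈⟨ solve 3 (λ q z c → q :* (z :* c) := z :* q :* c) refl q _ _ ⟩
        zpow q k * q * C 0ℤ       ≈⟨ *-cong (zpow-suc q≉0 k) refl ⟨
        zpow q (k ℤ.+ 1ℤ) * C 0ℤ  ∎
      down : ∀ k → C k ≈ zpow q k * C 0ℤ → C (k ℤ.- 1ℤ) ≈ zpow q (k ℤ.- 1ℤ) * C 0ℤ
      down k ih = *-cancelˡ q≉0 (begin
        q * C (k ℤ.- 1ℤ)                 ≈⟨ casoratian-suc (k ℤ.- 1ℤ) ⟨
        C (k ℤ.- 1ℤ ℤ.+ 1ℤ)              ≡⟨ ≡.cong C (pred-suc k) ⟩
        C k                              ≈⟨ ih ⟩
        zpow q k * C 0ℤ                  ≈⟨ *-cong (zpow-pred q≉0 k) refl ⟩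
        zpow q (k ℤ.- 1ℤ) * q * C 0ℤ     ≈⟨ solve 3 (λ q z c → z :* q :* c := q :* (z :* c)) refl q _ _ ⟩
        q * (zpow q (k ℤ.- 1ℤ) * C 0ℤ)   ∎)
        where pred-suc : ∀ k → k ℤ.- 1ℤ ℤ.+ 1ℤ ≡ k
              pred-suc = solve-∀

  U-W-identity : ∀ a b m d r →
    U p q (d ℤ.+ r) * W a b p q (m ℤ.+ d) - U p q d * W a b p q (m ℤ.+ d ℤ.+ r) ≈
    zpow q d * U p q r * W a b p q m
  U-W-identity a b m d r = x∙y⁻¹≈ε⇒x≈y _ _ (begin
    U′ (d ℤ.+ r) * Wₐ (m ℤ.+ d) - U′ d * Wₐ (m ℤ.+ d ℤ.+ r) - Q * U′ r * Wₐ m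
      ≈⟨ solve 7 (λ a w u v Q b t → a :* w :- u :* v :- Q :* b :* t := a :* w :- v :* u :- b :* (Q :* t)) refl _ _ _ _ Q _ _ ⟩
    S r ≈⟨ recurrent-zero S-rec S0 S1 r ⟩
    0# ∎)
    where
    U′ = U p q
    Wₐ = W a b p q
    Q = zpow q d
    S : ℤ → Carrier
    S n = U′ (d ℤ.+ n) * Wₐ (m ℤ.+ d) - Wₐ (m ℤ.+ d ℤ.+ n) * U′ d - U′ n * (Q * Wₐ m)
    S-rec : Recurrent S
    S-rec = recurrent-- (recurrent-- (recurrent-scale (recurrent-shift U-recurrent d) _)
                                     (recurrent-scale (recurrent-shift (W-recurrent a b) (m ℤ.+ d)) _))
                        (recurrent-scale U-recurrent _)
    S0 : S 0ℤ ≈ 0#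
    S0 = begin
      S 0ℤ ≡⟨ ≡.cong₂ (λ i i′ → U′ i * Wₐ (m ℤ.+ d) - Wₐ i′ * U′ d - 0# * (Q * Wₐ m)) (ℤₚ.+-identityʳ d) (ℤₚ.+-identityʳ (m ℤ.+ d)) ⟩
      U′ d * Wₐ (m ℤ.+ d) - Wₐ (m ℤ.+ d) * U′ d - 0# * (Q * Wₐ m)
        ≈⟨ solve 3 (λ u w t → u :* w :- w :* u :- con 0ℤ :* t := con 0ℤ) refl _ _ _ ⟩
      0# ∎
    Wₘ : ℤ → Carrier
    Wₘ n = Wₐ (m ℤ.+ n)
    C₀ : casoratian U′ Wₘ 0ℤ ≈ Wₐ m
    C₀ = begin
      1# * Wₐ (m ℤ.+ 0ℤ) - 0# * Wₐ (m ℤ.+ 1ℤ) ≡⟨ ≡.cong (λ i → 1# * Wₐ i - 0# * Wₐ (m ℤ.+ 1ℤ)) (ℤₚ.+-identityʳ m) ⟩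
      1# * Wₐ m - 0# * Wₐ (m ℤ.+ 1ℤ)          ≈⟨ solve 3 (λ o w v → o :* w :- con 0ℤ :* v := o :* w) refl 1# _ _ ⟩
      1# * Wₐ m                               ≈⟨ *-identityˡ _ ⟩
      Wₐ m ∎
    S1 : S 1ℤ ≈ 0#
    S1 = begin
      S 1ℤ
        ≈⟨ +-cong (+-cong refl (-‿cong (*-comm _ _))) (-‿cong (*-identityˡ _)) ⟩
      U′ (d ℤ.+ 1ℤ) * Wₐ (m ℤ.+ d) - U′ d * Wₐ (m ℤ.+ d ℤ.+ 1ℤ) - Q * Wₐ m
        ≡⟨ ≡.cong (λ i → U′ (d ℤ.+ 1ℤ) * Wₐ (m ℤ.+ d) - U′ d * Wₐ i - Q * Wₐ m) (ℤₚ.+-assoc m d 1ℤ) ⟩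
      casoratian U′ Wₘ d - Q * Wₐ m
        ≈⟨ +-cong (casoratian-zpow U-recurrent (recurrent-shift (W-recurrent a b) m) d) refl ⟩
      Q * casoratian U′ Wₘ 0ℤ - Q * Wₐ m
        ≈⟨ +-cong (*-cong refl C₀) refl ⟩
      Q * Wₐ m - Q * Wₐ m
        ≈⟨ -‿inverseʳ _ ⟩
      0# ∎

module IteratedSum {ℓ₁ ℓ₂ : Level} (K : Field ℓ₁ ℓ₂) (a b p q : Field.Carrier K)
  (q≉0 : ¬ (Field._≈_ K q (Field.0# K))) (r s c d : ℤ)
  (Ur≉0  : ¬ (Field._≈_ K (FieldOps.U K p q r) (Field.0# K)))
  (Ud≉0  : ¬ (Field._≈_ K (FieldOps.U K p q d) (Field.0# K)))
  (Urd≉0 : ¬ (Field._≈_ K (FieldOps.U K p q (r ℤ.+ d)) (Field.0# K))) where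
  open Field K
  open FieldOps K
  open FieldLemmas K
  open Recurrence K p q q≉0
  open import Relation.Binary.Reasoning.Setoid setoid
  open import Algebra.Properties.Ring ring using (-1*x≈-x; -0#≈0#)

  Wₐ : ℤ → Carrier
  Wₐ = W a b p q

  x : Carrier
  x = U p q d * U p q (r ℤ.+ d) ⁻¹

  ρ : Carrier
  ρ = - (U p q d * U p q r ⁻¹ * zpow q d ⁻¹)

  f : ℤ → Carrier
  f a₀ = zpow x a₀ * Wₐ (r ℤ.* a₀ ℤ.+ s)

  leading : ℕ → ℤ → Carrier
  leading n k = pow ρ n * zpow x k * Wₐ ((r ℤ.+ d) ℤ.* + n ℤ.+ r ℤ.* k ℤ.+ s)

  coefficient : ℕ → Carrier
  coefficient m = pow ρ m * Wₐ (r ℤ.* (+ m ℤ.+ c ℤ.- 1ℤ) ℤ.+ d ℤ.* + m ℤ.+ s)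

  summand : ℕ → ℤ → ℕ → Carrier
  summand n k j = coefficient (n ℕ.∸ j) * fromℤ (binomℤ (k ℤ.+ + j ℤ.- c) j)

  closedForm : ℕ → ℤ → Carrier
  closedForm n k = leading n k - zpow x (c ℤ.- 1ℤ) * sumNat n (summand n k)

  x≉0 : ¬ (x ≈ 0#)
  x≉0 = *-nonzero Ud≉0 (⁻¹-nonzero Urd≉0)

  ρ-step : ∀ m → ρ * (x * Wₐ (m ℤ.+ d ℤ.+ r) - Wₐ (m ℤ.+ d)) ≈ x * Wₐ m
  ρ-step m = begin
    ρ * (x * W₁ - W₂)
      ≈⟨ *-cong refl (+-cong refl (-‿cong (sym (trans (*-cong (⁻¹-inverseˡ Urd≉0) refl) (*-identityˡ W₂))))) ⟩
    ρ * (Ud * Urd ⁻¹ * W₁ - Urd ⁻¹ * Urd * W₂)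
      ≈⟨ solve 7 (λ ud ur′ q′ urd′ urd w₁ w₂ →
                  :- (ud :* ur′ :* q′) :* (ud :* urd′ :* w₁ :- urd′ :* urd :* w₂)
                  := ud :* ur′ :* q′ :* urd′ :* (urd :* w₂ :- ud :* w₁))
               refl Ud (Ur ⁻¹) (Q ⁻¹) (Urd ⁻¹) Urd W₁ W₂ ⟩
    Ud * Ur ⁻¹ * Q ⁻¹ * Urd ⁻¹ * (Urd * W₂ - Ud * W₁)
      ≈⟨ *-cong refl identity ⟩
    Ud * Ur ⁻¹ * Q ⁻¹ * Urd ⁻¹ * (Q * Ur * Wₐ m)
      ≈⟨ solve 7 (λ ud ur q urd′ ur′ q′ w →
                  ud :* ur′ :* q′ :* urd′ :* (q :* ur :* w)
                  := ur :* ur′ :* (q :* q′) :* (ud :* urd′ :* w))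
               refl Ud Ur Q (Urd ⁻¹) (Ur ⁻¹) (Q ⁻¹) (Wₐ m) ⟩
    Ur * Ur ⁻¹ * (Q * Q ⁻¹) * (x * Wₐ m)
      ≈⟨ *-cong (*-cong (⁻¹-inverse Ur Ur≉0) (⁻¹-inverse Q (zpow-nonzero d q≉0))) refl ⟩
    1# * 1# * (x * Wₐ m)
      ≈⟨ trans (*-cong (*-identityˡ 1#) refl) (*-identityˡ _) ⟩
    x * Wₐ m ∎
    where
    Ud = U p q d
    Ur = U p q r
    Urd = U p q (r ℤ.+ d)
    Q = zpow q d
    W₁ = Wₐ (m ℤ.+ d ℤ.+ r)
    W₂ = Wₐ (m ℤ.+ d)
    identity : Urd * W₂ - Ud * W₁ ≈ Q * Ur * Wₐ m
    identity = trans (reflexive (≡.cong (λ i → U p q i * W₂ - Ud * W₁) (ℤₚ.+-comm r d)))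
                     (U-W-identity a b m d r)

  leading-diff : ∀ n k → leading (suc n) k - leading (suc n) (k ℤ.- 1ℤ) ≈ leading n k
  leading-diff n k = begin
    leading (suc n) k - leading (suc n) (k ℤ.- 1ℤ)
      ≡⟨ ≡.cong₂ (λ i i′ → ρ * ρⁿ * zpow x k * Wₐ i - ρ * ρⁿ * xᵏ⁻¹ * Wₐ i′) (index₁ r d (+ n) k s) (index₂ r d (+ n) k s) ⟩
    ρ * ρⁿ * zpow x k * W₁ - ρ * ρⁿ * xᵏ⁻¹ * W₂
      ≈⟨ +-cong (*-cong (*-cong refl (zpow-pred x≉0 k)) refl) refl ⟩
    ρ * ρⁿ * (xᵏ⁻¹ * x) * W₁ - ρ * ρⁿ * xᵏ⁻¹ * W₂
      ≈⟨ solve 6 (λ ρ ρⁿ y x w₁ w₂ → ρ :* ρⁿ :* (y :* x) :* w₁ :- ρ :* ρⁿ :* y :* w₂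
                                      := ρⁿ :* y :* (ρ :* (x :* w₁ :- w₂)))
               refl ρ ρⁿ xᵏ⁻¹ x W₁ W₂ ⟩
    ρⁿ * xᵏ⁻¹ * (ρ * (x * W₁ - W₂))
      ≈⟨ *-cong refl (ρ-step m) ⟩
    ρⁿ * xᵏ⁻¹ * (x * Wₐ m)
      ≈⟨ solve 4 (λ ρⁿ y x w → ρⁿ :* y :* (x :* w) := ρⁿ :* (y :* x) :* w) refl ρⁿ xᵏ⁻¹ x (Wₐ m) ⟩
    ρⁿ * (xᵏ⁻¹ * x) * Wₐ m
      ≈⟨ *-cong (*-cong refl (zpow-pred x≉0 k)) refl ⟨
    leading n k ∎
    where
    ρⁿ = pow ρ n
    xᵏ⁻¹ = zpow x (k ℤ.- 1ℤ)
    m = (r ℤ.+ d) ℤ.* + n ℤ.+ r ℤ.* k ℤ.+ s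
    W₁ = Wₐ (m ℤ.+ d ℤ.+ r)
    W₂ = Wₐ (m ℤ.+ d)
    index₁ : ∀ r d n k s → (r ℤ.+ d) ℤ.* (1ℤ ℤ.+ n) ℤ.+ r ℤ.* k ℤ.+ s ≡
                           (r ℤ.+ d) ℤ.* n ℤ.+ r ℤ.* k ℤ.+ s ℤ.+ d ℤ.+ r
    index₁ = solve-∀
    index₂ : ∀ r d n k s → (r ℤ.+ d) ℤ.* (1ℤ ℤ.+ n) ℤ.+ r ℤ.* (k ℤ.- 1ℤ) ℤ.+ s ≡
                           (r ℤ.+ d) ℤ.* n ℤ.+ r ℤ.* k ℤ.+ s ℤ.+ d
    index₂ = solve-∀

  binom-pascal : ∀ N j → fromℤ (binomℤ (N ℤ.+ 1ℤ) (suc j)) - fromℤ (binomℤ N (suc j)) ≈ fromℤ (binomℤ N j)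
  binom-pascal N j = begin
    fromℤ (binomℤ (N ℤ.+ 1ℤ) (suc j)) - fromℤ (binomℤ N (suc j))
      ≡⟨ ≡.cong (λ z → fromℤ z - fromℤ (binomℤ N (suc j))) (binomℤ-pascal N j) ⟩
    fromℤ (binomℤ N (suc j) ℤ.+ binomℤ N j) - fromℤ (binomℤ N (suc j))
      ≈⟨ +-cong (fromℤ-+ (binomℤ N (suc j)) (binomℤ N j)) refl ⟩
    fromℤ (binomℤ N (suc j)) + fromℤ (binomℤ N j) - fromℤ (binomℤ N (suc j))
      ≈⟨ solve 2 (λ u v → u :+ v :- u := v) refl _ _ ⟩
    fromℤ (binomℤ N j) ∎

  summands-diff : ∀ n k → sumNat (suc n) (summand (suc n) k) - sumNat (suc n) (summand (suc n) (k ℤ.- 1ℤ)) ≈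
                          sumNat n (summand n k)
  summands-diff n k = begin
    sumNat (suc n) (summand (suc n) k) - sumNat (suc n) (summand (suc n) (k ℤ.- 1ℤ))
      ≈⟨ sumNat-homo-- (suc n) _ _ ⟩
    sumNat (suc n) D                    ≈⟨ sumNat-suc n D ⟩
    D 0 + sumNat n (λ j → D (suc j))    ≈⟨ +-cong (-‿inverseʳ _) (sumNat-cong n D-suc) ⟩
    0# + sumNat n (summand n k)         ≈⟨ +-identityˡ _ ⟩
    sumNat n (summand n k)              ∎
    where
    D : ℕ → Carrier
    D j = summand (suc n) k j - summand (suc n) (k ℤ.- 1ℤ) j
    D-suc : ∀ j → D (suc j) ≈ summand n k j
    D-suc j = begin
      w * fromℤ (binomℤ (k ℤ.+ + suc j ℤ.- c) (suc j)) - w * fromℤ (binomℤ (k ℤ.- 1ℤ ℤ.+ + suc j ℤ.- c) (suc j))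
        ≈⟨ solve 3 (λ w u v → w :* u :- w :* v := w :* (u :- v)) refl w _ _ ⟩
      w * (fromℤ (binomℤ (k ℤ.+ + suc j ℤ.- c) (suc j)) - fromℤ (binomℤ (k ℤ.- 1ℤ ℤ.+ + suc j ℤ.- c) (suc j)))
        ≡⟨ ≡.cong₂ (λ u v → w * (fromℤ (binomℤ u (suc j)) - fromℤ (binomℤ v (suc j)))) (upper k (+ j) c) (lower k (+ j) c) ⟩
      w * (fromℤ (binomℤ (k ℤ.+ + j ℤ.- c ℤ.+ 1ℤ) (suc j)) - fromℤ (binomℤ (k ℤ.+ + j ℤ.- c) (suc j)))
        ≈⟨ *-cong refl (binom-pascal (k ℤ.+ + j ℤ.- c) j) ⟩
      summand n k j ∎
      where
      w = coefficient (n ℕ.∸ j)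
      upper : ∀ k j c → k ℤ.+ (1ℤ ℤ.+ j) ℤ.- c ≡ k ℤ.+ j ℤ.- c ℤ.+ 1ℤ
      upper = solve-∀
      lower : ∀ k j c → k ℤ.- 1ℤ ℤ.+ (1ℤ ℤ.+ j) ℤ.- c ≡ k ℤ.+ j ℤ.- c
      lower = solve-∀

  closedForm-diff : ∀ n k → closedForm (suc n) k - closedForm (suc n) (k ℤ.- 1ℤ) ≈ closedForm n k
  closedForm-diff n k = begin
    closedForm (suc n) k - closedForm (suc n) (k ℤ.- 1ℤ)
      ≈⟨ solve 5 (λ a b z u v → a :- z :* u :- (b :- z :* v) := a :- b :- z :* (u :- v)) refl _ _ _ _ _ ⟩
    leading (suc n) k - leading (suc n) (k ℤ.- 1ℤ)
      - zpow x (c ℤ.- 1ℤ) * (sumNat (suc n) (summand (suc n) k) - sumNat (suc n) (summand (suc n) (k ℤ.- 1ℤ)))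
      ≈⟨ +-cong (leading-diff n k) (-‿cong (*-cong refl (summands-diff n k))) ⟩
    closedForm n k ∎

  closedForm-vanishes : ∀ n → closedForm (suc n) (c ℤ.- 1ℤ) ≈ 0#
  closedForm-vanishes n = begin
    ρⁿ⁺¹ * xᶜ⁻¹ * Wₐ ((r ℤ.+ d) ℤ.* + suc n ℤ.+ r ℤ.* (c ℤ.- 1ℤ) ℤ.+ s) - xᶜ⁻¹ * sumNat (suc n) h
      ≈⟨ +-cong (*-cong refl (reflexive (≡.cong Wₐ (index r d (+ n) c s)))) (-‿cong (*-cong refl (sumNat-suc n h))) ⟩
    ρⁿ⁺¹ * xᶜ⁻¹ * w - xᶜ⁻¹ * (h 0 + sumNat n (λ j → h (suc j)))
      ≈⟨ +-cong refl (-‿cong (*-cong refl (+-cong h-zero (sumNat-zero n _ h-suc)))) ⟩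
    ρⁿ⁺¹ * xᶜ⁻¹ * w - xᶜ⁻¹ * (ρⁿ⁺¹ * w + 0#)
      ≈⟨ solve 3 (λ ρ z w → ρ :* z :* w :- z :* (ρ :* w :+ con 0ℤ) := con 0ℤ) refl ρⁿ⁺¹ xᶜ⁻¹ w ⟩
    0# ∎
    where
    ρⁿ⁺¹ = pow ρ (suc n)
    xᶜ⁻¹ = zpow x (c ℤ.- 1ℤ)
    h = summand (suc n) (c ℤ.- 1ℤ)
    w = Wₐ (r ℤ.* (+ suc n ℤ.+ c ℤ.- 1ℤ) ℤ.+ d ℤ.* + suc n ℤ.+ s)
    index : ∀ r d n c s → (r ℤ.+ d) ℤ.* (1ℤ ℤ.+ n) ℤ.+ r ℤ.* (c ℤ.- 1ℤ) ℤ.+ s ≡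
                          r ℤ.* (1ℤ ℤ.+ n ℤ.+ c ℤ.- 1ℤ) ℤ.+ d ℤ.* (1ℤ ℤ.+ n) ℤ.+ s
    index = solve-∀
    h-zero : h 0 ≈ ρⁿ⁺¹ * w
    h-zero = trans (*-cong refl (+-identityʳ 1#)) (*-identityʳ _)
    h-suc : ∀ j → h (suc j) ≈ 0#
    h-suc j = begin
      coefficient (n ℕ.∸ j) * fromℤ (binomℤ (c ℤ.- 1ℤ ℤ.+ + suc j ℤ.- c) (suc j))
        ≡⟨ ≡.cong (λ i → coefficient (n ℕ.∸ j) * fromℤ (binomℤ i (suc j))) (bottom c (+ j)) ⟩
      coefficient (n ℕ.∸ j) * fromℤ (binomℤ (+ j) (suc j))
        ≡⟨ ≡.cong (λ z → coefficient (n ℕ.∸ j) * fromℤ z) (binomℤ-n-suc-n j) ⟩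
      coefficient (n ℕ.∸ j) * 0#
        ≈⟨ zeroʳ _ ⟩
      0# ∎
      where bottom : ∀ c j → c ℤ.- 1ℤ ℤ.+ (1ℤ ℤ.+ j) ℤ.- c ≡ j
            bottom = solve-∀

  closedForm-zero : ∀ k → f k ≈ closedForm 0 k
  closedForm-zero k = sym (begin
    1# * zpow x k * Wₐ ((r ℤ.+ d) ℤ.* + 0 ℤ.+ r ℤ.* k ℤ.+ s) - zpow x (c ℤ.- 1ℤ) * 0#
      ≡⟨ ≡.cong (λ i → 1# * zpow x k * Wₐ i - zpow x (c ℤ.- 1ℤ) * 0#) (index r d k s) ⟩
    1# * zpow x k * Wₐ (r ℤ.* k ℤ.+ s) - zpow x (c ℤ.- 1ℤ) * 0#
      ≈⟨ solve 4 (λ o z w y → o :* z :* w :- y :* con 0ℤ := o :* z :* w) refl 1# _ _ _ ⟩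
    1# * zpow x k * Wₐ (r ℤ.* k ℤ.+ s)
      ≈⟨ *-cong (*-identityˡ _) refl ⟩
    f k ∎)
    where index : ∀ r d k s → (r ℤ.+ d) ℤ.* 0ℤ ℤ.+ r ℤ.* k ℤ.+ s ≡ r ℤ.* k ℤ.+ s
          index = solve-∀

  iterSum≈closedForm : ∀ n k → iterSum c f n k ≈ closedForm n k
  iterSum≈closedForm zero    k = closedForm-zero k
  iterSum≈closedForm (suc n) k = begin
    sumZ c k (iterSum c f n)
      ≈⟨ sumZ-telescope (closedForm (suc n)) (λ j → trans (iterSum≈closedForm n j) (sym (closedForm-diff n j))) c k ⟩
    closedForm (suc n) k - closedForm (suc n) (c ℤ.- 1ℤ)
      ≈⟨ +-cong refl (trans (-‿cong (closedForm-vanishes n)) -0#≈0#) ⟩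
    closedForm (suc n) k + 0#
      ≈⟨ +-identityʳ _ ⟩
    closedForm (suc n) k ∎

  ρ-pow : ∀ m → pow (- 1#) m * zpow q (d ℤ.* + m) ⁻¹ * pow (U p q d * U p q r ⁻¹) m ≈ pow ρ m
  ρ-pow zero    = begin
    1# * zpow q (d ℤ.* + 0) ⁻¹ * 1#  ≡⟨ ≡.cong (λ i → 1# * zpow q i ⁻¹ * 1#) (ℤₚ.*-zeroʳ d) ⟩
    1# * 1# ⁻¹ * 1#                  ≈⟨ *-identityʳ _ ⟩
    1# * 1# ⁻¹                       ≈⟨ trans (*-identityˡ _) 1⁻¹≈1 ⟩
    1#                               ∎
  ρ-pow (suc m) = begin
    - 1# * ε * zpow q (d ℤ.* + suc m) ⁻¹ * (y * yᵐ)
      ≈⟨ *-cong (*-cong refl Qᵐ⁺¹⁻¹) refl ⟩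
    - 1# * ε * (Q ⁻¹ * Qᵐ ⁻¹) * (y * yᵐ)
      ≈⟨ solve 6 (λ o ε Q′ Qᵐ′ y yᵐ → :- o :* ε :* (Q′ :* Qᵐ′) :* (y :* yᵐ) := :- o :* (y :* Q′) :* (ε :* Qᵐ′ :* yᵐ))
               refl 1# ε (Q ⁻¹) (Qᵐ ⁻¹) y yᵐ ⟩
    - 1# * (y * Q ⁻¹) * (ε * Qᵐ ⁻¹ * yᵐ)
      ≈⟨ *-cong (-1*x≈-x _) (ρ-pow m) ⟩
    pow ρ (suc m) ∎
    where
    ε = pow (- 1#) m
    y = U p q d * U p q r ⁻¹
    yᵐ = pow y m
    Q = zpow q d
    Qᵐ = zpow q (d ℤ.* + m)
    Qᵐ⁺¹⁻¹ : zpow q (d ℤ.* + suc m) ⁻¹ ≈ Q ⁻¹ * Qᵐ ⁻¹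
    Qᵐ⁺¹⁻¹ = begin
      zpow q (d ℤ.* (1ℤ ℤ.+ + m)) ⁻¹ ≡⟨ ≡.cong (λ i → zpow q i ⁻¹) (ℤₚ.*-distribˡ-+ d 1ℤ (+ m)) ⟩
      zpow q (d ℤ.* 1ℤ ℤ.+ d ℤ.* + m) ⁻¹ ≡⟨ ≡.cong (λ i → zpow q (i ℤ.+ d ℤ.* + m) ⁻¹) (ℤₚ.*-identityʳ d) ⟩
      zpow q (d ℤ.+ d ℤ.* + m) ⁻¹ ≈⟨ ⁻¹-cong (zpow-nonzero (d ℤ.+ d ℤ.* + m) q≉0) (zpow-homo-+ q≉0 d (d ℤ.* + m)) ⟩
      (Q * Qᵐ) ⁻¹ ≈⟨ ⁻¹-distrib-* (zpow-nonzero d q≉0) (zpow-nonzero (d ℤ.* + m) q≉0) ⟩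
      Q ⁻¹ * Qᵐ ⁻¹ ∎

  leading-coefficient : ∀ n k →
    pow (- 1#) n * zpow (U p q d) (+ n ℤ.+ k) * (zpow q (d ℤ.* + n) * pow (U p q r) n * zpow (U p q (r ℤ.+ d)) k) ⁻¹ ≈
    pow ρ n * zpow x k
  leading-coefficient n k = begin
    ε * zpow Ud (+ n ℤ.+ k) * (Qⁿ * Urⁿ * Urdᵏ) ⁻¹
      ≈⟨ *-cong (*-cong refl (zpow-homo-+ Ud≉0 (+ n) k)) inverse ⟩
    ε * (Udⁿ * Udᵏ) * (Qⁿ ⁻¹ * Urⁿ ⁻¹ * Urdᵏ ⁻¹)
      ≈⟨ solve 6 (λ ε a b c d e → ε :* (a :* b) :* (c :* d :* e) := ε :* c :* (a :* d) :* (b :* e))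
               refl ε Udⁿ Udᵏ (Qⁿ ⁻¹) (Urⁿ ⁻¹) (Urdᵏ ⁻¹) ⟩
    ε * Qⁿ ⁻¹ * (Udⁿ * Urⁿ ⁻¹) * (Udᵏ * Urdᵏ ⁻¹)
      ≈⟨ *-cong (*-cong refl yⁿ) xᵏ ⟨
    ε * Qⁿ ⁻¹ * pow (Ud * Ur ⁻¹) n * zpow x k
      ≈⟨ *-cong (ρ-pow n) refl ⟩
    pow ρ n * zpow x k ∎
    where
    ε = pow (- 1#) n
    Ud = U p q d
    Ur = U p q r
    Urd = U p q (r ℤ.+ d)
    Udⁿ = pow Ud n
    Udᵏ = zpow Ud k
    Qⁿ = zpow q (d ℤ.* + n)
    Urⁿ = pow Ur n
    Urdᵏ = zpow Urd k
    Qⁿ≉0 = zpow-nonzero (d ℤ.* + n) q≉0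
    Urⁿ≉0 = pow-nonzero n Ur≉0
    inverse : (Qⁿ * Urⁿ * Urdᵏ) ⁻¹ ≈ Qⁿ ⁻¹ * Urⁿ ⁻¹ * Urdᵏ ⁻¹
    inverse = trans (⁻¹-distrib-* (*-nonzero Qⁿ≉0 Urⁿ≉0) (zpow-nonzero k Urd≉0))
                    (*-cong (⁻¹-distrib-* Qⁿ≉0 Urⁿ≉0) refl)
    yⁿ : pow (Ud * Ur ⁻¹) n ≈ Udⁿ * Urⁿ ⁻¹
    yⁿ = trans (pow-distrib-* Ud (Ur ⁻¹) n) (*-cong refl (pow-⁻¹ n Ur≉0))
    xᵏ : zpow x k ≈ Udᵏ * Urdᵏ ⁻¹
    xᵏ = trans (zpow-distrib-* Ud≉0 (⁻¹-nonzero Urd≉0) k) (*-cong refl (zpow-⁻¹ Urd≉0 k))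

theorem5 : ∀ {c ℓ : Level} (K : Field c ℓ) →
    let open Field K in
    let open FieldOps K in
    (a b p q : Carrier) → ¬ (p ≈ 0#) → ¬ (q ≈ 0#) →
    (r s cc d aₙ : ℤ) → ¬ (r ≡ ℤ.0ℤ) → ¬ (r ℤ.+ d ≡ ℤ.0ℤ) →
    ¬ (U p q r ≈ 0#) → ¬ (U p q d ≈ 0#) → ¬ (U p q (r ℤ.+ d) ≈ 0#) →
    (n : ℕ) → 1 ℕ.≤ n →
    iterSum cc
      (λ a₀ → zpow (U p q d * (U p q (r ℤ.+ d) ⁻¹)) a₀ * W a b p q (r ℤ.* a₀ ℤ.+ s))
      n aₙ
    ≈
    (pow (- 1#) n * zpow (U p q d) (+ n ℤ.+ aₙ)
       * ((zpow q (d ℤ.* + n) * pow (U p q r) n * zpow (U p q (r ℤ.+ d)) aₙ) ⁻¹)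
       * W a b p q ((r ℤ.+ d) ℤ.* + n ℤ.+ r ℤ.* aₙ ℤ.+ s)
     - zpow (U p q d * (U p q (r ℤ.+ d) ⁻¹)) (cc ℤ.- ℤ.1ℤ)
       * sumNat n (λ j →
           pow (- 1#) (n ℕ.∸ j)
           * (zpow q (d ℤ.* + (n ℕ.∸ j)) ⁻¹)
           * pow (U p q d * (U p q r ⁻¹)) (n ℕ.∸ j)
           * W a b p q (r ℤ.* (+ (n ℕ.∸ j) ℤ.+ cc ℤ.- ℤ.1ℤ) ℤ.+ d ℤ.* + (n ℕ.∸ j) ℤ.+ s)
           * fromℤ (binomℤ (aₙ ℤ.+ + j ℤ.- cc) j)))
theorem5 K a b p q _ q≉0 r s cc d aₙ _ _ Ur≉0 Ud≉0 Urd≉0 n _ =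
  trans (iterSum≈closedForm n aₙ)
        (+-cong (*-cong (sym (leading-coefficient n aₙ)) refl)
                (-‿cong (*-cong refl (sumNat-cong n λ j → *-cong (*-cong (sym (ρ-pow (n ℕ.∸ j))) refl) refl))))
  where open Field K
        open IteratedSum K a b p q q≉0 r s cc d Ur≉0 Ud≉0 Urd≉0
        open FieldLemmas K using (sumNat-cong)
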